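{- Let $q$ be a prime power and $n,k$ integers with $n>2k\geq 6$. Let $X$ be the set of $k$-dimensional subspaces of an $n$-dimensional $\mathbb{F}_q$-vector space $V$, regarded as the vertex set of the Grassmann graph $J_q(n,k)$ with distance $\partial$, and pick $x,y\in X$ with $1<\partial(x,y)<k$. With $F^+,F^-$ as defined below, for every $w\in\mathcal{A}_{xy}$ the $(w,x)$-entry of $F^+F^-$ is $0$.
   Context: Vertices $u,v\in X$ are adjacent when $\dim(u\cap v)=k-1$; $\Gamma(x)$ is the set of neighbours of $x$, and $\mathcal{A}_{xy}=\{z\in\Gamma(x):\partial(z,y)=\partial(x,y)\}$. $P$ is the set of all subspaces of $V$ and matrices are in $\mathrm{Mat}_P(\mathbb{C})$. For $u\in P$ with $\dim(u\cap y)=a$, $\dim u=a+b$ write $u\in P_{a,b}$. If $u\subseteq v$, $\dim v=\dim u+1$, $u\in P_{a,b}$, then $v\in P_{a+1,b}$ ($v$ $/$-covers $u$) or $v\in P_{a,b+1}$ ($v$ $\backslash$-covers $u$). $(F^+)_{u,v}=1$ if $u+v$ $\backslash$-covers each of $u,v$, else $0$; $(F^-)_{u,v}=1$ if each of $u,v$ $/$-covers $u\cap v$, else $0$. -}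

module Defs where

open import Level using (0ℓ)
open import Data.Nat using (ℕ; zero; suc; _^_; _∸_; _≤_; _<_)
open import Data.Nat.Primality using (Prime)
open import Data.Fin using (Fin)
open import Data.Product using (Σ; _×_; _,_; ∃)
open import Relation.Nullary using (¬_)
open import Relation.Binary.PropositionalEquality using (_≡_)
open import Algebra.Structures using (IsCommutativeRing)

IsPrimePower : ℕ → Set
IsPrimePower q = Σ ℕ λ p → Σ ℕ λ e → Prime p × q ≡ p ^ suc e

record FiniteField (q : ℕ) : Set where
  field
    _+_ _*_ : Fin q → Fin q → Fin q
    -_      : Fin q → Fin q
    0# 1#   : Fin q
    isCommutativeRing : IsCommutativeRing _≡_ _+_ _*_ -_ 0# 1#
    0≢1     : ¬ (0# ≡ 1#)
    inverse : ∀ x → ¬ (x ≡ 0#) → Σ (Fin q) λ y → x * y ≡ 1#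

module Grassmann {q : ℕ} (𝔽 : FiniteField q) (n : ℕ) where
  open FiniteField 𝔽

  F : Set
  F = Fin q

  Vec : Set
  Vec = Fin n → F

  _≈_ : Vec → Vec → Set
  u ≈ v = ∀ i → u i ≡ v i

  0v : Vec
  0v _ = 0#

  _⊕_ : Vec → Vec → Vec
  (u ⊕ v) i = u i + v i

  _·_ : F → Vec → Vec
  (c · v) i = c * v i

  ΣF : (d : ℕ) → (Fin d → F) → F
  ΣF zero    f = 0#
  ΣF (suc d) f = f Fin.zero + ΣF d (λ j → f (Fin.suc j))

  comb : {d : ℕ} → (Fin d → Vec) → (Fin d → F) → Vec
  comb {d} vs c i = ΣF d (λ j → c j * vs j i)

  Sub : Set₁
  Sub = Vec → Set

  record IsSubspace (U : Sub) : Set where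
    field
      respects : ∀ {u v} → u ≈ v → U u → U v
      has0     : U 0v
      closed+  : ∀ {u v} → U u → U v → U (u ⊕ v)
      closed·  : ∀ c {v} → U v → U (c · v)

  HasDim : Sub → ℕ → Set
  HasDim U d = Σ (Fin d → Vec) λ vs →
      (∀ j → U (vs j))
    × (∀ c → comb vs c ≈ 0v → ∀ j → c j ≡ 0#)
    × (∀ v → U v → Σ (Fin d → F) λ c → v ≈ comb vs c)

  _⊆_ : Sub → Sub → Set
  U ⊆ W = ∀ v → U v → W v

  _∩_ : Sub → Sub → Sub
  (U ∩ W) v = U v × W v

  _+S_ : Sub → Sub → Sub
  (U +S W) v = Σ Vec λ a → Σ Vec λ b → U a × W b × v ≈ (a ⊕ b)

  SameSub : Sub → Sub → Set
  SameSub U W = U ⊆ W × W ⊆ U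

  module _ (k : ℕ) where
    IsVertex : Sub → Set
    IsVertex U = IsSubspace U × HasDim U k

    Adj : Sub → Sub → Set
    Adj U W = HasDim (U ∩ W) (k ∸ 1)

    data Walk : Sub → Sub → ℕ → Set₁ where
      nil  : ∀ {U W} → SameSub U W → Walk U W 0
      step : ∀ {U W m} (Z : Sub) → IsVertex Z → Adj U Z → Walk Z W m → Walk U W (suc m)

    Dist : Sub → Sub → ℕ → Set₁
    Dist U W m = Walk U W m × (∀ m' → Walk U W m' → m ≤ m')

    -- w ∈ A_xy = { z ∈ Γ(x) : ∂(z,y) = ∂(x,y) }
    InA : Sub → Sub → Sub → Set₁
    InA x y z = IsVertex z × Adj x z × Σ ℕ λ m → Dist x y m × Dist z y m

  module _ (y : Sub) where
    Covers : Sub → Sub → Set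
    Covers v u = u ⊆ v × Σ ℕ λ d → HasDim u d × HasDim v (suc d)

    SlashCovers : Sub → Sub → Set
    SlashCovers v u = Covers v u × Σ ℕ λ a → HasDim (u ∩ y) a × HasDim (v ∩ y) (suc a)

    BackslashCovers : Sub → Sub → Set
    BackslashCovers v u = Covers v u × Σ ℕ λ a → HasDim (u ∩ y) a × HasDim (v ∩ y) a

    F⁺ : Sub → Sub → Set
    F⁺ u v = BackslashCovers (u +S v) u × BackslashCovers (u +S v) v

    F⁻ : Sub → Sub → Set
    F⁻ u v = SlashCovers u (u ∩ v) × SlashCovers v (u ∩ v)

-- Put s = w + u. Since s \-covers both w and u, s ∩ y has the dimension of w ∩ y and of
-- u ∩ y, so s ∩ y = w ∩ y = u ∩ y. Since u and x /-cover u ∩ x, neither u ∩ y ⊆ x nor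
-- x ∩ y ⊆ u. Hence w ∩ y ⊈ x (it equals u ∩ y); take t ∈ w ∩ y outside x, so t ∈ u.
-- If x ∩ w ⊆ u, then w = (x ∩ w) + ⟨t⟩ ⊆ u, so s = u, contradicting dim s = dim u + 1.
-- Otherwise some g ∈ x ∩ w lies outside u, so x = (u ∩ x) + ⟨g⟩ ⊆ s and x ∩ y ⊆ s ∩ y ⊆ u,
-- a contradiction.
module Submission where

open import Defs
open import Level using (0ℓ)
open import Data.Nat using (ℕ; zero; suc; _*_; _∸_; _^_; _<_; _≤_; s≤s; z≤n)
import Data.Nat.Properties as ℕₚ
open import Data.Fin using (Fin; combine; finToFun; funToFin)
import Data.Fin.Properties as Finₚ
open import Data.Vec.Functional using (_∷_)
open import Data.Product using (Σ; _×_; _,_; proj₁; proj₂)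
open import Data.Sum using (_⊎_; inj₁; inj₂)
open import Data.Empty using (⊥; ⊥-elim)
open import Function using (_∘_)
open import Relation.Nullary using (¬_; Dec; yes; no)
open import Relation.Binary.PropositionalEquality
open import Algebra.Bundles using (CommutativeRing)

module LinearAlgebra {q : ℕ} (𝔽 : FiniteField q) (n : ℕ) where
  open FiniteField 𝔽 renaming (_*_ to _⋆_)
  open Grassmann 𝔽 n

  ring : CommutativeRing 0ℓ 0ℓ
  ring = record { isCommutativeRing = isCommutativeRing }

  open CommutativeRing ring
    using (+-identityˡ; +-identityʳ; *-assoc; *-comm; *-identityˡ; zeroˡ;
           distribˡ; distribʳ; -‿inverseʳ; +-commutativeSemigroup)
  open import Algebra.Properties.Ring (CommutativeRing.ring ring)
    using (-‿distribˡ-*; -‿+-comm; -0#≈0#; +-inverseˡ-unique; x∙y⁻¹≈ε⇒x≈y)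
  open import Algebra.Properties.CommutativeSemigroup +-commutativeSemigroup
    using (interchange)

  ΣF-cong : ∀ d {f g : Fin d → F} → (∀ j → f j ≡ g j) → ΣF d f ≡ ΣF d g
  ΣF-cong zero    f≗g = refl
  ΣF-cong (suc d) f≗g = cong₂ _+_ (f≗g Fin.zero) (ΣF-cong d (f≗g ∘ Fin.suc))

  ΣF-distrib-+ : ∀ d (f g : Fin d → F) → ΣF d (λ j → f j + g j) ≡ (ΣF d f + ΣF d g)
  ΣF-distrib-+ zero    f g = sym (+-identityˡ 0#)
  ΣF-distrib-+ (suc d) f g =
    trans (cong ((f Fin.zero + g Fin.zero) +_) (ΣF-distrib-+ d (f ∘ Fin.suc) (g ∘ Fin.suc)))
          (interchange _ _ _ _)

  *-distribˡ-ΣF : ∀ d a (f : Fin d → F) → ΣF d (λ j → a ⋆ f j) ≡ (a ⋆ ΣF d f)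
  *-distribˡ-ΣF zero    a f = sym (trans (*-comm a 0#) (zeroˡ a))
  *-distribˡ-ΣF (suc d) a f =
    trans (cong ((a ⋆ f Fin.zero) +_) (*-distribˡ-ΣF d a (f ∘ Fin.suc))) (sym (distribˡ a _ _))

  -‿distrib-ΣF : ∀ d (f : Fin d → F) → ΣF d (λ j → - f j) ≡ (- ΣF d f)
  -‿distrib-ΣF zero    f = sym -0#≈0#
  -‿distrib-ΣF (suc d) f =
    trans (cong ((- f Fin.zero) +_) (-‿distrib-ΣF d (f ∘ Fin.suc))) (-‿+-comm _ _)

  ≈-sym : ∀ {u v} → u ≈ v → v ≈ u
  ≈-sym u≈v i = sym (u≈v i)

  ≈-trans : ∀ {u v w} → u ≈ v → v ≈ w → u ≈ w
  ≈-trans u≈v v≈w i = trans (u≈v i) (v≈w i)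

  ≈-dec : ∀ u v → Dec (u ≈ v)
  ≈-dec u v = Finₚ.all? (λ i → u i Finₚ.≟ v i)

  Independent : ∀ {d} → (Fin d → Vec) → Set
  Independent vs = ∀ c → comb vs c ≈ 0v → ∀ j → c j ≡ 0#

  InSpan : ∀ {d} → (Fin d → Vec) → Vec → Set
  InSpan {d} vs v = Σ (Fin d → F) λ c → v ≈ comb vs c

  module _ {d : ℕ} (vs : Fin d → Vec) where

    comb-cong : ∀ {c c'} → (∀ j → c j ≡ c' j) → comb vs c ≈ comb vs c'
    comb-cong c≗c' i = ΣF-cong d (λ j → cong (_⋆ vs j i) (c≗c' j))

    comb-distrib-+ : ∀ c c' → comb vs (λ j → c j + c' j) ≈ (comb vs c ⊕ comb vs c')
    comb-distrib-+ c c' i =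
      trans (ΣF-cong d (λ j → distribʳ (vs j i) (c j) (c' j))) (ΣF-distrib-+ d _ _)

    comb-distrib-· : ∀ a c → comb vs (λ j → a ⋆ c j) ≈ (a · comb vs c)
    comb-distrib-· a c i =
      trans (ΣF-cong d (λ j → *-assoc a (c j) (vs j i))) (*-distribˡ-ΣF d a _)

    comb-distrib-neg : ∀ c i → comb vs (λ j → - c j) i ≡ (- comb vs c i)
    comb-distrib-neg c i =
      trans (ΣF-cong d (λ j → sym (-‿distribˡ-* (c j) (vs j i)))) (-‿distrib-ΣF d _)

    independent⇒comb-injective :
      Independent vs → ∀ c c' → comb vs c ≈ comb vs c' → ∀ j → c j ≡ c' j
    independent⇒comb-injective indep c c' eq j =
      x∙y⁻¹≈ε⇒x≈y (c j) (c' j) (indep (λ j → c j + (- c' j)) difference≈0 j)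
      where
      difference≈0 : comb vs (λ j → c j + (- c' j)) ≈ 0v
      difference≈0 i = begin
        comb vs (λ j → c j + (- c' j)) i   ≡⟨ comb-distrib-+ c _ i ⟩
        comb vs c i + comb vs (λ j → - c' j) i ≡⟨ cong (comb vs c i +_) (comb-distrib-neg c' i) ⟩
        comb vs c i + (- comb vs c' i)   ≡⟨ cong (_+ (- comb vs c' i)) (eq i) ⟩
        comb vs c' i + (- comb vs c' i)  ≡⟨ -‿inverseʳ _ ⟩
        0#                               ∎
        where open ≡-Reasoning

    comb-closed : ∀ {S} → IsSubspace S → (∀ j → S (vs j)) → ∀ c → S (comb vs c)
    comb-closed {S} S-sub vs∈S c = go d vs vs∈S c
      where
      open IsSubspace S-sub
      go : ∀ e (us : Fin e → Vec) → (∀ j → S (us j)) → ∀ c → S (comb us c)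
      go zero    us us∈S c = respects (λ _ → refl) has0
      go (suc e) us us∈S c = respects (λ _ → refl)
        (closed+ (closed· (c Fin.zero) (us∈S Fin.zero))
                 (go e (us ∘ Fin.suc) (us∈S ∘ Fin.suc) (c ∘ Fin.suc)))

    span⊆ : ∀ {S} → IsSubspace S → (∀ j → S (vs j)) → ∀ v → InSpan vs v → S v
    span⊆ S-sub vs∈S v (c , v≈comb) =
      IsSubspace.respects S-sub (≈-sym v≈comb) (comb-closed S-sub vs∈S c)

    -- Decidable because the coefficient vectors Fin d → F can be enumerated as Fin (q ^ d).
    inSpan? : ∀ v → Dec (InSpan vs v)
    inSpan? v with Finₚ.any? (λ i → ≈-dec v (comb vs (finToFun i)))
    ... | yes (i , v≈comb) = yes (finToFun i , v≈comb)
    ... | no ¬found = no λ (c , v≈comb) →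
      ¬found (funToFin c , ≈-trans v≈comb (comb-cong (sym ∘ Finₚ.finToFun-funToFin c)))

    ∷-independent : ∀ {v} → Independent vs → ¬ InSpan vs v → Independent (v ∷ vs)
    ∷-independent {v} indep v∉span c c≈0 = c≡0
      where
      rest : Vec
      rest = comb vs (c ∘ Fin.suc)
      tail≈0 : c Fin.zero ≡ 0# → rest ≈ 0v
      tail≈0 c₀≡0 i = begin
        rest i                        ≡⟨ +-identityˡ (rest i) ⟨
        0# + rest i                   ≡⟨ cong (_+ rest i) (trans (cong (_⋆ v i) c₀≡0) (zeroˡ (v i))) ⟨
        (c Fin.zero ⋆ v i) + rest i   ≡⟨ c≈0 i ⟩
        0#                            ∎
        where open ≡-Reasoning
      -- If c₀ ≠ 0 then v = c₀⁻¹ · (- Σ c_{j+1} vs_j) would lie in the span.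
      head≡0 : c Fin.zero ≡ 0#
      head≡0 with c Fin.zero Finₚ.≟ 0#
      ... | yes c₀≡0 = c₀≡0
      ... | no c₀≢0 with inverse (c Fin.zero) c₀≢0
      ...   | c₀⁻¹ , c₀c₀⁻¹≡1 = ⊥-elim (v∉span (_ , ≈-sym v≈comb))
        where
        open ≡-Reasoning
        v≈comb : comb vs (λ j → c₀⁻¹ ⋆ (- c (Fin.suc j))) ≈ v
        v≈comb i = begin
          comb vs (λ j → c₀⁻¹ ⋆ (- c (Fin.suc j))) i ≡⟨ comb-distrib-· c₀⁻¹ _ i ⟩
          c₀⁻¹ ⋆ comb vs (λ j → - c (Fin.suc j)) i ≡⟨ cong (c₀⁻¹ ⋆_) (comb-distrib-neg _ i) ⟩
          c₀⁻¹ ⋆ (- rest i)                       ≡⟨ cong (c₀⁻¹ ⋆_) (+-inverseˡ-unique _ _ (c≈0 i)) ⟨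
          c₀⁻¹ ⋆ (c Fin.zero ⋆ v i)               ≡⟨ *-assoc c₀⁻¹ _ _ ⟨
          (c₀⁻¹ ⋆ c Fin.zero) ⋆ v i               ≡⟨ cong (_⋆ v i) (trans (*-comm c₀⁻¹ _) c₀c₀⁻¹≡1) ⟩
          1# ⋆ v i                                ≡⟨ *-identityˡ (v i) ⟩
          v i                                     ∎
      c≡0 : ∀ j → c j ≡ 0#
      c≡0 Fin.zero    = head≡0
      c≡0 (Fin.suc j) = indep (c ∘ Fin.suc) (tail≈0 head≡0) j

  ∷-all : ∀ {S : Sub} {d v} {vs : Fin d → Vec} → S v → (∀ j → S (vs j)) → ∀ j → S ((v ∷ vs) j)
  ∷-all v∈S vs∈S Fin.zero    = v∈S
  ∷-all v∈S vs∈S (Fin.suc j) = vs∈S j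

  1<q : 1 < q
  1<q = distinct⇒1< 0≢1
    where
    distinct⇒1< : ∀ {m} {a b : Fin m} → a ≢ b → 1 < m
    distinct⇒1< {suc zero}    {Fin.zero} {Fin.zero} a≢b = ⊥-elim (a≢b refl)
    distinct⇒1< {suc (suc m)}                        _   = s≤s (s≤s z≤n)

  funToFin-cong : ∀ {d m} {f g : Fin d → Fin m} → (∀ j → f j ≡ g j) → funToFin f ≡ funToFin g
  funToFin-cong {zero}  f≗g = refl
  funToFin-cong {suc d} f≗g = cong₂ combine (f≗g Fin.zero) (funToFin-cong (f≗g ∘ Fin.suc))

  -- An injection F^d → F^e gives an injection Fin (q ^ d) → Fin (q ^ e), and q > 1.
  coefficient-injection⇒≤ : ∀ {d e} (φ : (Fin d → F) → (Fin e → F)) →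
    (∀ c c' → (∀ j → φ c j ≡ φ c' j) → ∀ j → c j ≡ c' j) → d ≤ e
  coefficient-injection⇒≤ {d} {e} φ φ-injective =
    ℕₚ.≮⇒≥ (λ e<d → ℕₚ.<⇒≱ (ℕₚ.^-monoʳ-< q 1<q e<d) (Finₚ.injective⇒≤ ψ-injective))
    where
    ψ : Fin (q ^ d) → Fin (q ^ e)
    ψ = funToFin ∘ φ ∘ finToFun
    ψ-injective : ∀ {i i'} → ψ i ≡ ψ i' → i ≡ i'
    ψ-injective {i} {i'} ψi≡ψi' = begin
      i                               ≡⟨ Finₚ.funToFin-finToFin {d} {q} i ⟨
      funToFin (finToFun {q} {d} i)   ≡⟨ funToFin-cong (φ-injective _ _ φ-equal) ⟩
      funToFin (finToFun {q} {d} i')  ≡⟨ Finₚ.funToFin-finToFin {d} {q} i' ⟩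
      i'                              ∎
      where
      open ≡-Reasoning
      φ-equal : ∀ j → φ (finToFun i) j ≡ φ (finToFun i') j
      φ-equal j = trans (sym (Finₚ.finToFun-funToFin _ j))
                        (trans (cong (λ k → finToFun k j) ψi≡ψi') (Finₚ.finToFun-funToFin _ j))

  independent⇒≤dim : ∀ {S e} → IsSubspace S → HasDim S e →
    ∀ {d} (vs : Fin d → Vec) → Independent vs → (∀ j → S (vs j)) → d ≤ e
  independent⇒≤dim {e = e} S-sub (bs , _ , _ , bs-span) {d} vs indep vs∈S =
    coefficient-injection⇒≤ coordinates coordinates-injective
    where
    coordinates : (Fin d → F) → (Fin e → F)
    coordinates c = proj₁ (bs-span (comb vs c) (comb-closed vs S-sub vs∈S c))
    coordinates-injective : ∀ c c' → (∀ j → coordinates c j ≡ coordinates c' j) → ∀ j → c j ≡ c' j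
    coordinates-injective c c' eq = independent⇒comb-injective vs indep c c'
      (≈-trans (proj₂ (bs-span _ _)) (≈-trans (comb-cong bs eq) (≈-sym (proj₂ (bs-span _ _)))))

  independent⇒spanning : ∀ {S d} → IsSubspace S → HasDim S d →
    (vs : Fin d → Vec) → Independent vs → (∀ j → S (vs j)) → ∀ v → S v → InSpan vs v
  independent⇒spanning {S} S-sub S-dim vs indep vs∈S v v∈S with inSpan? vs v
  ... | yes v∈span = v∈span
  ... | no  v∉span = ⊥-elim (ℕₚ.1+n≰n (independent⇒≤dim S-sub S-dim (v ∷ vs)
                      (∷-independent vs indep v∉span) (∷-all {S = S} v∈S vs∈S)))

  dim-mono : ∀ {A S d e} → IsSubspace S → HasDim S e → HasDim A d → A ⊆ S → d ≤ e
  dim-mono S-sub S-dim (as , as∈A , as-indep , _) A⊆S =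
    independent⇒≤dim S-sub S-dim as as-indep (λ j → A⊆S _ (as∈A j))

  dim-unique : ∀ {S d e} → IsSubspace S → HasDim S d → HasDim S e → d ≡ e
  dim-unique S-sub S-d S-e =
    ℕₚ.≤-antisym (dim-mono S-sub S-e S-d (λ _ v∈S → v∈S)) (dim-mono S-sub S-d S-e (λ _ v∈S → v∈S))

  ¬⊆-smaller-dim : ∀ {A S a} → IsSubspace S → HasDim A (suc a) → HasDim S a → ¬ A ⊆ S
  ¬⊆-smaller-dim S-sub A-dim S-dim A⊆S = ℕₚ.1+n≰n (dim-mono S-sub S-dim A-dim A⊆S)

  ⊆-equal-dim⇒⊇ : ∀ {A S d} → IsSubspace A → IsSubspace S → HasDim A d → HasDim S d →
    A ⊆ S → S ⊆ A
  ⊆-equal-dim⇒⊇ A-sub S-sub (as , as∈A , as-indep , _) S-dim A⊆S v v∈S =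
    span⊆ as A-sub as∈A v
      (independent⇒spanning S-sub S-dim as as-indep (λ j → A⊆S _ (as∈A j)) v v∈S)

  ∈-dec : ∀ {S d} → IsSubspace S → HasDim S d → ∀ v → Dec (S v)
  ∈-dec S-sub (bs , bs∈S , _ , bs-span) v with inSpan? bs v
  ... | yes v∈span = yes (span⊆ bs S-sub bs∈S v v∈span)
  ... | no  v∉span = no (v∉span ∘ bs-span v)

  ⊆⊎∃∉ : ∀ {U S d e} → IsSubspace S → HasDim S e → HasDim U d →
    U ⊆ S ⊎ Σ Vec λ t → U t × ¬ S t
  ⊆⊎∃∉ S-sub S-dim (us , us∈U , _ , us-span) with Finₚ.all? (∈-dec S-sub S-dim ∘ us)
  ... | yes us∈S = inj₁ λ v v∈U → span⊆ us S-sub us∈S v (us-span v v∈U)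
  ... | no  ¬us∈S with Finₚ.¬∀⟶∃¬ _ _ (∈-dec S-sub S-dim ∘ us) ¬us∈S
  ...   | j , uj∉S = inj₂ (us j , us∈U j , uj∉S)

  -- W = H + ⟨t⟩ when H is a hyperplane of W and t ∈ W ∖ H.
  hyperplane-and-point-⊆ : ∀ {H W S d t} → IsSubspace H → IsSubspace W → IsSubspace S →
    HasDim H d → HasDim W (suc d) → H ⊆ W → W t → ¬ H t → H ⊆ S → S t → W ⊆ S
  hyperplane-and-point-⊆ {W = W} {S} {t = t} H-sub W-sub S-sub (hs , hs∈H , hs-indep , _) W-dim
    H⊆W t∈W t∉H H⊆S t∈S v v∈W =
    span⊆ (t ∷ hs) S-sub (∷-all {S = S} t∈S (λ j → H⊆S _ (hs∈H j))) v
      (independent⇒spanning W-sub W-dim (t ∷ hs) t∷hs-indep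
         (∷-all {S = W} t∈W (λ j → H⊆W _ (hs∈H j))) v v∈W)
    where
    t∷hs-indep : Independent (t ∷ hs)
    t∷hs-indep = ∷-independent hs hs-indep (t∉H ∘ span⊆ hs H-sub hs∈H t)

  ∩-subspace : ∀ {U W} → IsSubspace U → IsSubspace W → IsSubspace (U ∩ W)
  ∩-subspace U-sub W-sub = record
    { respects = λ e (u∈U , u∈W) → U.respects e u∈U , W.respects e u∈W
    ; has0     = U.has0 , W.has0
    ; closed+  = λ (u∈U , u∈W) (v∈U , v∈W) → U.closed+ u∈U v∈U , W.closed+ u∈W v∈W
    ; closed·  = λ c (u∈U , u∈W) → U.closed· c u∈U , W.closed· c u∈W
    }
    where
    module U = IsSubspace U-sub
    module W = IsSubspace W-sub

  +S-subspace : ∀ {U W} → IsSubspace U → IsSubspace W → IsSubspace (U +S W)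
  +S-subspace U-sub W-sub = record
    { respects = λ e (a , b , a∈U , b∈W , v≈a+b) → a , b , a∈U , b∈W , ≈-trans (≈-sym e) v≈a+b
    ; has0     = 0v , 0v , U.has0 , W.has0 , (λ _ → sym (+-identityˡ 0#))
    ; closed+  = λ (a , b , a∈U , b∈W , v≈a+b) (a' , b' , a'∈U , b'∈W , v'≈a'+b') →
        a ⊕ a' , b ⊕ b' , U.closed+ a∈U a'∈U , W.closed+ b∈W b'∈W ,
        λ i → trans (cong₂ _+_ (v≈a+b i) (v'≈a'+b' i)) (interchange (a i) (b i) (a' i) (b' i))
    ; closed·  = λ c (a , b , a∈U , b∈W , v≈a+b) →
        c · a , c · b , U.closed· c a∈U , W.closed· c b∈W ,
        λ i → trans (cong (c ⋆_) (v≈a+b i)) (distribˡ c (a i) (b i))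
    }
    where
    module U = IsSubspace U-sub
    module W = IsSubspace W-sub

  ⊆-+Sˡ : ∀ {U W} → IsSubspace W → U ⊆ (U +S W)
  ⊆-+Sˡ W-sub v v∈U = v , 0v , v∈U , IsSubspace.has0 W-sub , λ i → sym (+-identityʳ (v i))

  ⊆-+Sʳ : ∀ {U W} → IsSubspace U → W ⊆ (U +S W)
  ⊆-+Sʳ U-sub v v∈W = 0v , v , IsSubspace.has0 U-sub , v∈W , λ i → sym (+-identityˡ (v i))

  +S-least : ∀ {U W S} → IsSubspace S → U ⊆ S → W ⊆ S → (U +S W) ⊆ S
  +S-least S-sub U⊆S W⊆S v (a , b , a∈U , b∈W , v≈a+b) =
    IsSubspace.respects S-sub (≈-sym v≈a+b) (IsSubspace.closed+ S-sub (U⊆S a a∈U) (W⊆S b b∈W))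

  ∩-monoˡ : ∀ {U W} Y → U ⊆ W → (U ∩ Y) ⊆ (W ∩ Y)
  ∩-monoˡ Y U⊆W v (v∈U , v∈Y) = U⊆W v v∈U , v∈Y

  module _ {y : Sub} (y-sub : IsSubspace y) where

    covers⇒⊈ : ∀ {u v} → IsSubspace u → Covers y v u → ¬ v ⊆ u
    covers⇒⊈ u-sub (_ , _ , u-dim , v-dim) = ¬⊆-smaller-dim u-sub v-dim u-dim

    backslashCovers⇒∩⊆ : ∀ {c v} → IsSubspace c → IsSubspace v →
      BackslashCovers y v c → (v ∩ y) ⊆ c
    backslashCovers⇒∩⊆ c-sub v-sub ((c⊆v , _) , _ , cy-dim , vy-dim) u u∈vy =
      proj₁ (⊆-equal-dim⇒⊇ (∩-subspace c-sub y-sub) (∩-subspace v-sub y-sub)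
               cy-dim vy-dim (∩-monoˡ y c⊆v) u u∈vy)

    slashCovers⇒∩⊈ : ∀ {c v} → IsSubspace c → SlashCovers y v c → ¬ (v ∩ y) ⊆ c
    slashCovers⇒∩⊈ c-sub (_ , _ , cy-dim , vy-dim) vy⊆c =
      ¬⊆-smaller-dim (∩-subspace c-sub y-sub) vy-dim cy-dim
        (λ u u∈vy → vy⊆c u u∈vy , proj₂ u∈vy)

    F⁺F⁻-vanishes-on-adjacent : ∀ {k x w u} →
      IsSubspace x → HasDim x k → IsSubspace w → HasDim w k → HasDim (x ∩ w) (k ∸ 1) →
      IsSubspace u → F⁺ y w u → F⁻ y u x → ⊥
    F⁺F⁻-vanishes-on-adjacent {k} {x} {w} {u} x-sub x-dim w-sub w-dim xw-dim u-sub
      (w⋖s@(_ , _ , wy-dim , _) , u⋖s@((_ , _ , u-dim , _) , _))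
      (ux⋖u , ux⋖x@((_ , _ , ux-dim , x-dim′) , _)) =
      cases (⊆⊎∃∉ x-sub x-dim wy-dim)
      where
      s = w +S u
      s-sub = +S-subspace w-sub u-sub
      ux-sub = ∩-subspace u-sub x-sub

      sy⊆w : (s ∩ y) ⊆ w
      sy⊆w = backslashCovers⇒∩⊆ w-sub s-sub w⋖s
      sy⊆u : (s ∩ y) ⊆ u
      sy⊆u = backslashCovers⇒∩⊆ u-sub s-sub u⋖s
      uy⊈x : ¬ (u ∩ y) ⊆ x
      uy⊈x uy⊆x = slashCovers⇒∩⊈ ux-sub ux⋖u λ v v∈uy → proj₁ v∈uy , uy⊆x v v∈uy
      xy⊈u : ¬ (x ∩ y) ⊆ u
      xy⊈u xy⊆u = slashCovers⇒∩⊈ ux-sub ux⋖x λ v v∈xy → xy⊆u v v∈xy , proj₁ v∈xy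
      w⊈u : ¬ w ⊆ u
      w⊈u w⊆u = covers⇒⊈ u-sub (proj₁ u⋖s) (+S-least u-sub w⊆u λ _ v∈u → v∈u)

      w-dim′ : HasDim w (suc (k ∸ 1))
      w-dim′ = subst (HasDim w) (sym (trans (cong (λ j → suc (j ∸ 1)) k≡1+m) (sym k≡1+m))) w-dim
        where k≡1+m = dim-unique x-sub x-dim x-dim′

      cases : (w ∩ y) ⊆ x ⊎ Σ Vec (λ t → (w ∩ y) t × ¬ x t) → ⊥
      cases (inj₁ wy⊆x) = uy⊈x λ v (v∈u , v∈y) →
        wy⊆x v (sy⊆w v (⊆-+Sʳ w-sub v v∈u , v∈y) , v∈y)
      cases (inj₂ (t , (t∈w , t∈y) , t∉x)) with ⊆⊎∃∉ u-sub u-dim xw-dim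
      ... | inj₁ xw⊆u = w⊈u
        (hyperplane-and-point-⊆ (∩-subspace x-sub w-sub) w-sub u-sub xw-dim w-dim′
           (λ _ → proj₂) t∈w (t∉x ∘ proj₁) xw⊆u (sy⊆u t (⊆-+Sˡ u-sub t t∈w , t∈y)))
      ... | inj₂ (g , (g∈x , g∈w) , g∉u) = xy⊈u λ v (v∈x , v∈y) → sy⊆u v (x⊆s v v∈x , v∈y)
        where
        x⊆s : x ⊆ s
        x⊆s = hyperplane-and-point-⊆ ux-sub x-sub s-sub ux-dim x-dim′ (λ _ → proj₂)
                g∈x (g∉u ∘ proj₁) (λ v → ⊆-+Sʳ w-sub v ∘ proj₁) (⊆-+Sˡ u-sub g g∈w)

mainTheorem15 : (q : ℕ) → IsPrimePower q → (𝔽 : FiniteField q) → (n k : ℕ)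
    → 2 * k < n → 6 ≤ 2 * k
    → let open Grassmann 𝔽 n in
      (x y : Sub) → IsVertex k x → IsVertex k y
    → (d : ℕ) → Dist k x y d → 1 < d → d < k
    → (w : Sub) → InA k x y w
    → ¬ (Σ Sub λ u → IsSubspace u × F⁺ y w u × F⁻ y u x)
mainTheorem15 q _ 𝔽 n k _ _ x y (x-sub , x-dim) (y-sub , _) _ _ _ _
  w ((w-sub , w-dim) , x∼w , _) (u , u-sub , u∈F⁺ , u∈F⁻) =
  LinearAlgebra.F⁺F⁻-vanishes-on-adjacent 𝔽 n y-sub x-sub x-dim w-sub w-dim x∼w u-sub u∈F⁺ u∈F⁻
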